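{- Let $x[1..n]$ be a framed word as described in the context. For $i\in[1,n]$, let $z$ be the maximal inverse Lyndon subword of $x$ starting at position $i$ and let $j=\mathit{next}_{ -1}[i]$. Then $\mathrm{lce}(i,j)=\mathrm{border}(z)$, where $\mathrm{border}(z)$ is the length of the longest proper border of $z$.
   Context: Let $(\Sigma,<)$ be a totally ordered alphabet. The lexicographic order $\prec$ on words is: $u\prec v$ iff either $v=uw$ for some non-empty word $w$, or $u=ary$, $v=asy'$ for words $a,y,y'$ and letters $r<s$. A framed word is a word $x[1..n]$ ($n\ge 2$) with $x[1]=\#$, $x[n]=\$$ and $x[2..n-1]\in\Sigma^*$, where the order on $\Sigma$ is extended by $\# > \$ > a$ for all $a\in\Sigma$. For $1\le i\le n$, $x_i=x[i..n]$, and $x_{n+1}$ is the empty word. $\mathrm{lce}(i,j)$ is the length of the longest common prefix of $x_i$ and $x_j$. A non-empty word $w$ is an inverse Lyndon word if $s\prec w$ for every non-empty proper suffix $s$ of $w$. A subword $x[i..j]$ is a maximal inverse Lyndon subword starting at $i$ if it is an inverse Lyndon word and either $j=n$ or $x[i..j+1]$ is not an inverse Lyndon word. The next greater suffix array is $\mathit{next}_{ -1}[i]=\min\{j\in(i,n]\mid x_j\succ x_i\}$, with the conventions $\mathit{next}_{ -1}[1]=\mathit{next}_{ -1}[n]=n+1$. A border of a word $z$ is a word that is both a proper prefix and a proper suffix of $z$ (possibly empty). -}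

module Defs where

open import Level using (Level)
open import Data.Nat using (ℕ; zero; suc; _∸_; _≤_; _<_)
open import Data.List using (List; []; _∷_; _++_; map; length; take; drop)
open import Data.Product using (Σ; _×_; _,_)
open import Data.Sum using (_⊎_)
open import Relation.Binary.Core using (Rel)
open import Relation.Binary.Structures using (IsStrictTotalOrder)
open import Relation.Binary.PropositionalEquality using (_≡_; _≢_; refl; cong)
open import Relation.Nullary using (¬_; Dec; yes; no)

module Alphabet {ℓ : Level} (A : Set) (_<ₐ_ : Rel A ℓ)
                (isSTO : IsStrictTotalOrder _≡_ _<ₐ_) where

  data Ext : Set where
    hash   : Ext
    dollar : Ext
    letter : A → Ext

  data _<ₑ_ : Ext → Ext → Set ℓ where
    let<let    : ∀ {a b} → a <ₐ b → letter a <ₑ letter b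
    let<dollar : ∀ {a} → letter a <ₑ dollar
    let<hash   : ∀ {a} → letter a <ₑ hash
    dollar<hash : dollar <ₑ hash

  Word : Set
  Word = List Ext

  data _≺_ : Word → Word → Set ℓ where
    prefix : ∀ {b w} → [] ≺ (b ∷ w)
    differ : ∀ {r s u v} → r <ₑ s → (r ∷ u) ≺ (s ∷ v)
    same   : ∀ {c u v} → u ≺ v → (c ∷ u) ≺ (c ∷ v)

  _≟ₑ_ : (c d : Ext) → Dec (c ≡ d)
  hash ≟ₑ hash = yes refl
  hash ≟ₑ dollar = no (λ ())
  hash ≟ₑ letter _ = no (λ ())
  dollar ≟ₑ hash = no (λ ())
  dollar ≟ₑ dollar = yes refl
  dollar ≟ₑ letter _ = no (λ ())
  letter _ ≟ₑ hash = no (λ ())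
  letter _ ≟ₑ dollar = no (λ ())
  letter a ≟ₑ letter b with IsStrictTotalOrder._≟_ isSTO a b
  ... | yes refl = yes refl
  ... | no a≢b = no (λ { refl → a≢b refl })

  lcp : Word → Word → ℕ
  lcp [] _ = 0
  lcp (_ ∷ _) [] = 0
  lcp (c ∷ u) (d ∷ v) with c ≟ₑ d
  ... | yes _ = suc (lcp u v)
  ... | no _ = 0

  Framed : Word → Set
  Framed x = Σ (List A) λ w → x ≡ hash ∷ (map letter w ++ dollar ∷ [])

  -- x_i = x[i..n] (1-based); x_{n+1} is the empty word
  suf : Word → ℕ → Word
  suf x i = drop (i ∸ 1) x

  -- x[i..j] (1-based, inclusive)
  sub : Word → ℕ → ℕ → Word
  sub x i j = take (suc j ∸ i) (drop (i ∸ 1) x)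

  lce : Word → ℕ → ℕ → ℕ
  lce x i j = lcp (suf x i) (suf x j)

  InverseLyndon : Word → Set ℓ
  InverseLyndon w = (w ≢ []) × (∀ u s → u ≢ [] → s ≢ [] → w ≡ u ++ s → s ≺ w)

  MaxInvLyndonAt : Word → ℕ → ℕ → Set ℓ
  MaxInvLyndonAt x i j =
    (i ≤ j) × (j ≤ length x) × InverseLyndon (sub x i j)
      × ((j ≡ length x) ⊎ ¬ InverseLyndon (sub x i (suc j)))

  -- j = next_{-1}[i]  (with next_{-1}[1] = next_{-1}[n] = n+1, and n+1 when the set is empty)
  data NextGreater (x : Word) (i : ℕ) : ℕ → Set ℓ where
    conv-first : i ≡ 1 → NextGreater x i (suc (length x))
    conv-last  : i ≡ length x → NextGreater x i (suc (length x))
    found : ∀ {j} → i ≢ 1 → i ≢ length x → i < j → j ≤ length x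
          → suf x i ≺ suf x j
          → (∀ k → i < k → k < j → ¬ (suf x i ≺ suf x k))
          → NextGreater x i j
    none  : i ≢ 1 → i ≢ length x
          → (∀ k → i < k → k ≤ length x → ¬ (suf x i ≺ suf x k))
          → NextGreater x i (suc (length x))

  IsBorder : Word → Word → Set
  IsBorder b z = (Σ Word λ u → (u ≢ []) × (z ≡ b ++ u))
               × (Σ Word λ v → (v ≢ []) × (z ≡ v ++ b))

  IsBorderLength : Word → ℕ → Set
  IsBorderLength z k = (Σ Word λ b → IsBorder b z × (length b ≡ k))
                     × (∀ b → IsBorder b z → length b ≤ k)

-- Let y = x_i = z c t, where z is the maximal inverse Lyndon prefix, and let d = j - i, so that
-- y ≺ y[d..] while y[k..] ⪯ y for 0 < k < d.  Minimality of d forces every split z c = u s with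
-- |u| < d to satisfy s ≺ u s; by maximality z c is not inverse Lyndon, so d ≤ |z|.  Write
-- z = D P with |D| = d.  The suffix P of z must be a prefix of z (otherwise P c t ≺ z c t), so
-- z = P a Q.  If c < a then y[d..] = P c t ≺ y; if a = c then z c would be inverse Lyndon; hence
-- a < c, so lce(i, j) = |P| and P is a border.  A longer border w P (with D = v w) would be
-- followed in z by a letter a' ≤ a < c, which gives y ≺ y[|v|..] with 0 < |v| < d.
-- The framing reduces the remaining positions to this: x_1 starts with the unique #, x_n = $ has
-- no non-empty border, and for 1 < i < n the next greater suffix exists because $ ≻ x_i.

module Submission where

open import Defs
open import Level using (Level)
open import Data.Nat using (ℕ; zero; suc; _≤_; _<_; _∸_; _+_; _⊓_; z≤n; s≤s; _≤?_)
open import Data.Nat.Properties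
open import Data.List using (List; []; _∷_; _++_; [_]; length; take; drop; map)
open import Data.List.Properties
  using (length-++; length-++-≤ˡ; length-++-≤ʳ; length-take; length-drop; ++-assoc; ++-identityʳ;
         ++-conicalʳ; take++drop≡id; drop-drop; drop-all; ∷-injective)
open import Data.List.Relation.Unary.All as All using (All; _∷_)
open import Data.List.Relation.Unary.All.Properties using (++⁺; ++⁻ʳ; map⁺; take⁺)
open import Data.Product using (Σ; _×_; _,_; proj₁; proj₂)
open import Data.Sum using (_⊎_; inj₁; inj₂; [_,_]′)
open import Data.Empty using (⊥; ⊥-elim)
open import Relation.Binary.Core using (Rel)
open import Relation.Binary.Structures using (IsStrictTotalOrder)
open import Relation.Binary.Definitions using (tri<; tri≈; tri>)
open import Relation.Binary.PropositionalEquality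
  using (_≡_; _≢_; refl; sym; trans; cong; cong₂; subst; subst₂)
open import Relation.Nullary using (¬_; yes; no)

module _ {ℓ : Level} (A : Set) (_<ₐ_ : Rel A ℓ) (isSTO : IsStrictTotalOrder _≡_ _<ₐ_) where

  open Alphabet A _<ₐ_ isSTO
  private module STO = IsStrictTotalOrder isSTO

  <ₑ-irrefl : ∀ {a} → ¬ (a <ₑ a)
  <ₑ-irrefl (let<let a<a) = STO.irrefl refl a<a

  <ₑ-trans : ∀ {a b c} → a <ₑ b → b <ₑ c → a <ₑ c
  <ₑ-trans (let<let a<b) (let<let b<c) = let<let (STO.trans a<b b<c)
  <ₑ-trans (let<let _)   let<dollar    = let<dollar
  <ₑ-trans (let<let _)   let<hash      = let<hash
  <ₑ-trans let<dollar    dollar<hash   = let<hash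

  <ₑ-asym : ∀ {a b} → a <ₑ b → ¬ (b <ₑ a)
  <ₑ-asym a<b b<a = <ₑ-irrefl (<ₑ-trans a<b b<a)

  <ₑ-compare : ∀ a b → a <ₑ b ⊎ a ≡ b ⊎ b <ₑ a
  <ₑ-compare hash       hash       = inj₂ (inj₁ refl)
  <ₑ-compare hash       dollar     = inj₂ (inj₂ dollar<hash)
  <ₑ-compare hash       (letter _) = inj₂ (inj₂ let<hash)
  <ₑ-compare dollar     hash       = inj₁ dollar<hash
  <ₑ-compare dollar     dollar     = inj₂ (inj₁ refl)
  <ₑ-compare dollar     (letter _) = inj₂ (inj₂ let<dollar)
  <ₑ-compare (letter _) hash       = inj₁ let<hash
  <ₑ-compare (letter _) dollar     = inj₁ let<dollar
  <ₑ-compare (letter a) (letter b) with STO.compare a b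
  ... | tri< a<b _ _    = inj₁ (let<let a<b)
  ... | tri≈ _ refl _   = inj₂ (inj₁ refl)
  ... | tri> _ _ b<a    = inj₂ (inj₂ (let<let b<a))

  ≺-asym : ∀ {u v} → u ≺ v → ¬ (v ≺ u)
  ≺-asym (differ r<s) (differ s<r) = <ₑ-asym r<s s<r
  ≺-asym (differ r<r) (same _)     = <ₑ-irrefl r<r
  ≺-asym (same _)     (differ r<r) = <ₑ-irrefl r<r
  ≺-asym (same u≺v)   (same v≺u)   = ≺-asym u≺v v≺u

  ≺-compare : ∀ u v → u ≺ v ⊎ u ≡ v ⊎ v ≺ u
  ≺-compare []      []      = inj₂ (inj₁ refl)
  ≺-compare []      (_ ∷ _) = inj₁ prefix
  ≺-compare (_ ∷ _) []      = inj₂ (inj₂ prefix)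
  ≺-compare (a ∷ u) (b ∷ v) with <ₑ-compare a b
  ... | inj₁ a<b        = inj₁ (differ a<b)
  ... | inj₂ (inj₂ b<a) = inj₂ (inj₂ (differ b<a))
  ... | inj₂ (inj₁ refl) with ≺-compare u v
  ...   | inj₁ u≺v        = inj₁ (same u≺v)
  ...   | inj₂ (inj₁ refl) = inj₂ (inj₁ refl)
  ...   | inj₂ (inj₂ v≺u) = inj₂ (inj₂ (same v≺u))

  ≺-mismatch : ∀ p {r s} u v → r <ₑ s → (p ++ r ∷ u) ≺ (p ++ s ∷ v)
  ≺-mismatch []      u v r<s = differ r<s
  ≺-mismatch (_ ∷ p) u v r<s = same (≺-mismatch p u v r<s)

  ≺-proper-prefix : ∀ p q → q ≢ [] → p ≺ (p ++ q)
  ≺-proper-prefix p       []      q≢[] = ⊥-elim (q≢[] refl)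
  ≺-proper-prefix []      (_ ∷ _) _    = prefix
  ≺-proper-prefix (_ ∷ p) (c ∷ q) q≢[] = same (≺-proper-prefix p (c ∷ q) q≢[])

  ≺⇒proper-prefix⊎≺-++ : ∀ {u v} → u ≺ v →
    (Σ Word λ R → R ≢ [] × v ≡ u ++ R) ⊎ (∀ a b → (u ++ a) ≺ (v ++ b))
  ≺⇒proper-prefix⊎≺-++ (prefix {b} {w}) = inj₁ (b ∷ w , (λ ()) , refl)
  ≺⇒proper-prefix⊎≺-++ (differ r<s)     = inj₂ λ _ _ → differ r<s
  ≺⇒proper-prefix⊎≺-++ (same {c} u≺v) with ≺⇒proper-prefix⊎≺-++ u≺v
  ... | inj₁ (R , R≢[] , v≡uR) = inj₁ (R , R≢[] , cong (c ∷_) v≡uR)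
  ... | inj₂ u++≺v++           = inj₂ λ a b → same (u++≺v++ a b)

  []≺ : ∀ {u v} → u ≺ v → [] ≺ v
  []≺ prefix     = prefix
  []≺ (differ _) = prefix
  []≺ (same _)   = prefix

  u++r≺v⇒u≺v : ∀ u {r v} → (u ++ r) ≺ v → u ≺ v
  u++r≺v⇒u≺v []      ur≺v         = []≺ ur≺v
  u++r≺v⇒u≺v (_ ∷ u) (differ r<s) = differ r<s
  u++r≺v⇒u≺v (_ ∷ u) (same ur≺v)  = same (u++r≺v⇒u≺v u ur≺v)

  u≺v⇒u≺v++w : ∀ {u v} w → u ≺ v → u ≺ (v ++ w)
  u≺v⇒u≺v++w w prefix       = prefix
  u≺v⇒u≺v++w w (differ r<s) = differ r<s
  u≺v⇒u≺v++w w (same u≺v)   = same (u≺v⇒u≺v++w w u≺v)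

  lcp-[]ʳ : ∀ u → lcp u [] ≡ 0
  lcp-[]ʳ []      = refl
  lcp-[]ʳ (_ ∷ _) = refl

  lcp-mismatch : ∀ p {a b} u v → a ≢ b → lcp (p ++ a ∷ u) (p ++ b ∷ v) ≡ length p
  lcp-mismatch [] {a} {b} u v a≢b with a ≟ₑ b
  ... | yes a≡b = ⊥-elim (a≢b a≡b)
  ... | no _    = refl
  lcp-mismatch (c ∷ p) u v a≢b with c ≟ₑ c
  ... | yes _   = cong suc (lcp-mismatch p u v a≢b)
  ... | no c≢c  = ⊥-elim (c≢c refl)

  nonempty⇒1≤length : ∀ {u : Word} → u ≢ [] → 1 ≤ length u
  nonempty⇒1≤length {[]}    u≢[] = ⊥-elim (u≢[] refl)
  nonempty⇒1≤length {_ ∷ _} _    = s≤s z≤n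

  length-++-<ˡ : ∀ (u : Word) {s} → s ≢ [] → length u < length (u ++ s)
  length-++-<ˡ []      s≢[] = nonempty⇒1≤length s≢[]
  length-++-<ˡ (_ ∷ u) s≢[] = s≤s (length-++-<ˡ u s≢[])

  length-++-<ʳ : ∀ {u : Word} s → u ≢ [] → length s < length (u ++ s)
  length-++-<ʳ {[]}    s u≢[] = ⊥-elim (u≢[] refl)
  length-++-<ʳ {_ ∷ u} s _    = s≤s (length-++-≤ʳ s {u})

  ++-∷-≢[] : ∀ (p : Word) {a u} → p ++ a ∷ u ≢ []
  ++-∷-≢[] []      ()
  ++-∷-≢[] (_ ∷ _) ()

  drop-length-++ : ∀ (u v : Word) → drop (length u) (u ++ v) ≡ v
  drop-length-++ []      v = refl
  drop-length-++ (_ ∷ u) v = drop-length-++ u v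

  take-suc-∷ʳ : ∀ m (y : Word) {c t} → drop m y ≡ c ∷ t → take (suc m) y ≡ take m y ++ [ c ]
  take-suc-∷ʳ zero    (_ ∷ y) e = cong [_] (proj₁ (∷-injective e))
  take-suc-∷ʳ (suc m) (a ∷ y) e = cong (a ∷_) (take-suc-∷ʳ m y e)

  levi : ∀ (u s D X : Word) → u ++ s ≡ D ++ X →
    (Σ Word λ w → u ≡ D ++ w × X ≡ w ++ s) ⊎ (Σ Word λ w → w ≢ [] × D ≡ u ++ w × s ≡ w ++ X)
  levi u       s []      X e = inj₁ (u , refl , sym e)
  levi []      s (d ∷ D) X e = inj₂ (d ∷ D , (λ ()) , refl , e)
  levi (c ∷ u) s (d ∷ D) X e with ∷-injective e
  ... | refl , e′ with levi u s D X e′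
  ...   | inj₁ (w , u≡Dw , X≡ws)          = inj₁ (w , cong (c ∷_) u≡Dw , X≡ws)
  ...   | inj₂ (w , w≢[] , D≡uw , s≡wX) = inj₂ (w , w≢[] , cong (c ∷_) D≡uw , s≡wX)

  suffix-of-∷ʳ : ∀ (w s P : Word) c → w ++ s ≡ P ++ [ c ] → s ≢ [] →
    Σ Word λ w₂ → P ≡ w ++ w₂ × s ≡ w₂ ++ [ c ]
  suffix-of-∷ʳ []      s P       c e s≢[] = P , refl , e
  suffix-of-∷ʳ (_ ∷ w) s []      c e s≢[] = ⊥-elim (s≢[] (++-conicalʳ w s (proj₂ (∷-injective e))))
  suffix-of-∷ʳ (a ∷ w) s (_ ∷ P) c e s≢[] with ∷-injective e
  ... | refl , e′ with suffix-of-∷ʳ w s P c e′ s≢[]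
  ...   | w₂ , P≡ww₂ , s≡w₂c = w₂ , cong (a ∷_) P≡ww₂ , s≡w₂c

  inverseLyndon-suffix : ∀ {w D P} → InverseLyndon w → w ≡ D ++ P → D ≢ [] →
    (Σ Word λ R → R ≢ [] × w ≡ P ++ R) ⊎ (∀ a b → (P ++ a) ≺ (w ++ b))
  inverseLyndon-suffix {w} {P = []}    (w≢[] , _) _ _ = inj₁ (w , w≢[] , refl)
  inverseLyndon-suffix {P = p ∷ P} (_ , suffix≺) w≡DP D≢[] =
    ≺⇒proper-prefix⊎≺-++ (suffix≺ _ (p ∷ P) D≢[] (λ ()) w≡DP)

  ¬shift≻⇒suffix≺ : ∀ u s r → u ≢ [] → ¬ (((u ++ s) ++ r) ≺ (s ++ r)) → s ≺ (u ++ s)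
  ¬shift≻⇒suffix≺ u s r u≢[] ¬shift≻ with ≺-compare s (u ++ s)
  ... | inj₁ s≺us        = s≺us
  ... | inj₂ (inj₁ s≡us) = ⊥-elim (<-irrefl (cong length s≡us) (length-++-<ʳ s u≢[]))
  ... | inj₂ (inj₂ us≺s) with ≺⇒proper-prefix⊎≺-++ us≺s
  ...   | inj₂ us++≺s++ = ⊥-elim (¬shift≻ (us++≺s++ r r))
  ...   | inj₁ (R , _ , s≡usR) = ⊥-elim (<-irrefl refl (<-≤-trans (length-++-<ʳ s u≢[])
            (≤-trans (length-++-≤ˡ (u ++ s)) (≤-reflexive (cong length (sym s≡usR))))))

  border-shorter : ∀ {b z} → IsBorder b z → length b < length z
  border-shorter {b} ((u , u≢[] , z≡bu) , _) =
    <-≤-trans (length-++-<ˡ b u≢[]) (≤-reflexive (cong length (sym z≡bu)))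

  borderless : ∀ {z} → z ≢ [] → (∀ b → IsBorder b z → length b ≤ 0) → IsBorderLength z 0
  borderless {z} z≢[] ≤0 = ([] , ((z , z≢[] , refl) , (z , z≢[] , sym (++-identityʳ z))) , refl) , ≤0

  -- The core argument, for y = z c t and its next greater suffix y[d..]

  module NextGreaterShift (z : Word) (c : Ext) (t : Word) (d : ℕ)
    (z-inv : InverseLyndon z) (zc-¬inv : ¬ InverseLyndon (z ++ [ c ]))
    (1≤d : 1 ≤ d) (y≺shift : (z ++ c ∷ t) ≺ drop d (z ++ c ∷ t))
    (shift-minimal : ∀ k → 1 ≤ k → k < d → ¬ ((z ++ c ∷ t) ≺ drop k (z ++ c ∷ t))) where

    y : Word
    y = z ++ c ∷ t

    y-split : ∀ p q → z ≡ p ++ q → y ≡ p ++ (q ++ c ∷ t)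
    y-split p q z≡pq = trans (cong (_++ c ∷ t) z≡pq) (++-assoc p q (c ∷ t))

    shift-split : ∀ p q → z ≡ p ++ q → drop (length p) y ≡ q ++ c ∷ t
    shift-split p q z≡pq = trans (cong (drop (length p)) (y-split p q z≡pq)) (drop-length-++ p (q ++ c ∷ t))

    short-split-suffix≺ : ∀ u s → u ≢ [] → z ++ [ c ] ≡ u ++ s → length u < d → s ≺ (u ++ s)
    short-split-suffix≺ u s u≢[] zc≡us |u|<d = ¬shift≻⇒suffix≺ u s t u≢[] λ us≺s →
      shift-minimal (length u) (nonempty⇒1≤length u≢[]) |u|<d (subst₂ _≺_ (sym y≡ust) (sym shift≡st) us≺s)
      where
      y≡ust : y ≡ (u ++ s) ++ t
      y≡ust = trans (sym (++-assoc z [ c ] t)) (cong (_++ t) zc≡us)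
      shift≡st : drop (length u) y ≡ s ++ t
      shift≡st = trans (cong (drop (length u)) (trans y≡ust (++-assoc u s t))) (drop-length-++ u (s ++ t))

    d≤∣z∣ : d ≤ length z
    d≤∣z∣ with d ≤? length z
    ... | yes d≤∣z∣ = d≤∣z∣
    ... | no d≰∣z∣  = ⊥-elim (zc-¬inv (++-∷-≢[] z , λ u s u≢[] s≢[] zc≡us →
          subst (s ≺_) (sym zc≡us) (short-split-suffix≺ u s u≢[] zc≡us (∣u∣<d zc≡us s≢[]))))
      where
      ∣u∣<d : ∀ {u s} → z ++ [ c ] ≡ u ++ s → s ≢ [] → length u < d
      ∣u∣<d {u} {s} zc≡us s≢[] = <-≤-trans (length-++-<ˡ u s≢[]) (begin
        length (u ++ s)      ≡⟨ cong length (sym zc≡us) ⟩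
        length (z ++ [ c ])  ≡⟨ trans (length-++ z) (+-comm (length z) 1) ⟩
        suc (length z)       ≤⟨ ≰⇒> d≰∣z∣ ⟩
        d                    ∎)
        where open ≤-Reasoning

    D P : Word
    D = take d z
    P = drop d z

    z≡DP : z ≡ D ++ P
    z≡DP = sym (take++drop≡id d z)

    ∣D∣≡d : length D ≡ d
    ∣D∣≡d = trans (length-take d z) (m≤n⇒m⊓n≡m d≤∣z∣)

    D≢[] : D ≢ []
    D≢[] D≡[] = <-irrefl (trans (cong length (sym D≡[])) ∣D∣≡d) 1≤d

    shift≡Pct : drop d y ≡ P ++ c ∷ t
    shift≡Pct = subst (λ k → drop k y ≡ P ++ c ∷ t) ∣D∣≡d (shift-split D P z≡DP)

    inside-D : ∀ {u w} → D ≡ u ++ w → w ≢ [] → length u < d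
    inside-D {u} D≡uw w≢[] = subst (length u <_) (trans (cong length (sym D≡uw)) ∣D∣≡d) (length-++-<ˡ u w≢[])

    P-proper-prefix : Σ Word λ R → R ≢ [] × z ≡ P ++ R
    P-proper-prefix with inverseLyndon-suffix z-inv z≡DP D≢[]
    ... | inj₁ R = R
    ... | inj₂ P++≺z++ = ⊥-elim (≺-asym y≺shift (subst (_≺ y) (sym shift≡Pct) (P++≺z++ (c ∷ t) (c ∷ t))))

    -- If z = P c Q then z c is periodic with period d, and its short splits are covered by minimality.
    P-followed-by-c⇒inverseLyndon : ∀ {Q} → z ≡ P ++ c ∷ Q → InverseLyndon (z ++ [ c ])
    P-followed-by-c⇒inverseLyndon {Q} z≡PcQ = ++-∷-≢[] z , suffix≺
      where
      zc≡Pc++Qc : z ++ [ c ] ≡ (P ++ [ c ]) ++ (Q ++ [ c ])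
      zc≡Pc++Qc = trans (cong (_++ [ c ]) z≡PcQ)
                        (trans (++-assoc P (c ∷ Q) [ c ]) (sym (++-assoc P [ c ] (Q ++ [ c ]))))
      suffix≺ : ∀ u s → u ≢ [] → s ≢ [] → z ++ [ c ] ≡ u ++ s → s ≺ (z ++ [ c ])
      suffix≺ u s u≢[] s≢[] zc≡us
        with levi u s D (P ++ [ c ]) (trans (sym zc≡us) (trans (cong (_++ [ c ]) z≡DP) (++-assoc D P [ c ])))
      ... | inj₂ (w , w≢[] , D≡uw , _) =
        subst (s ≺_) (sym zc≡us) (short-split-suffix≺ u s u≢[] zc≡us (inside-D D≡uw w≢[]))
      ... | inj₁ (w , _ , Pc≡ws) with suffix-of-∷ʳ w s P c (sym Pc≡ws) s≢[]
      ...   | w₂ , P≡ww₂ , s≡w₂c with w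
      ...     | [] = subst₂ _≺_ (trans (cong (_++ [ c ]) P≡ww₂) (sym s≡w₂c)) (sym zc≡Pc++Qc)
                       (≺-proper-prefix (P ++ [ c ]) (Q ++ [ c ]) (++-∷-≢[] Q))
      ...     | a ∷ w′ = subst (_≺ (z ++ [ c ])) (sym s≡w₂c) (u≺v⇒u≺v++w [ c ]
                  (u++r≺v⇒u≺v (w₂ ++ [ c ]) (subst (_≺ z) (sym (++-assoc w₂ [ c ] Q))
                    (proj₂ z-inv (a ∷ w′) (w₂ ++ c ∷ Q) (λ ()) (++-∷-≢[] w₂)
                      (trans z≡PcQ (trans (cong (_++ c ∷ Q) P≡ww₂) (++-assoc (a ∷ w′) w₂ (c ∷ Q))))))))

    module _ {a Q} (a<c : a <ₑ c) (z≡PaQ : z ≡ P ++ a ∷ Q) where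

      a≮letter-after-P : ∀ w {a′ u′} → w ≢ [] → z ≡ w ++ (P ++ a′ ∷ u′) → ¬ (a <ₑ a′)
      a≮letter-after-P w {a′} {u′} w≢[] z≡wPa′u′ a<a′ =
        ≺-asym (proj₂ z-inv w (P ++ a′ ∷ u′) w≢[] (++-∷-≢[] P) z≡wPa′u′)
               (subst (_≺ (P ++ a′ ∷ u′)) (sym z≡PaQ) (≺-mismatch P Q u′ a<a′))

      letter-after-P<c : ∀ w {a′ u′} → w ≢ [] → z ≡ w ++ (P ++ a′ ∷ u′) → a′ <ₑ c
      letter-after-P<c w {a′} w≢[] z≡wPa′u′ with <ₑ-compare a′ c
      ... | inj₁ a′<c        = a′<c
      ... | inj₂ (inj₁ refl) = ⊥-elim (a≮letter-after-P w w≢[] z≡wPa′u′ a<c)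
      ... | inj₂ (inj₂ c<a′) = ⊥-elim (a≮letter-after-P w w≢[] z≡wPa′u′ (<ₑ-trans a<c c<a′))

      borders-≤P : ∀ b → IsBorder b z → length b ≤ length P
      borders-≤P b ((u , u≢[] , z≡bu) , (v , v≢[] , z≡vb)) with levi v b D P (trans (sym z≡vb) z≡DP)
      ... | inj₁ (w , _ , P≡wb) = subst (length b ≤_) (cong length (sym P≡wb)) (length-++-≤ʳ b {w})
      ... | inj₂ (w , w≢[] , D≡vw , b≡wP) = ⊥-elim (long-border u u≢[] z≡bu)
        where
        -- b = w P occurs in z at offset |v| < d, followed by a letter smaller than c.
        long-border : ∀ u → u ≢ [] → z ≡ b ++ u → ⊥
        long-border []         u≢[] _    = u≢[] refl
        long-border (a′ ∷ u′) _    z≡bu =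
          shift-minimal (length v) (nonempty⇒1≤length v≢[]) (inside-D D≡vw w≢[])
            (subst₂ _≺_ (sym (y-split b (a′ ∷ u′) z≡bu)) (sym (shift-split v b z≡vb)) (≺-mismatch b (u′ ++ c ∷ t) t a′<c))
          where
          a′<c : a′ <ₑ c
          a′<c = letter-after-P<c w w≢[]
                   (trans z≡bu (trans (cong (_++ a′ ∷ u′) b≡wP) (++-assoc w P (a′ ∷ u′))))

      P-longest-border : IsBorderLength z (length P)
      P-longest-border = (P , ((a ∷ Q , (λ ()) , z≡PaQ) , (D , D≢[] , z≡DP)) , refl) , borders-≤P

      lcp≡∣P∣ : lcp y (drop d y) ≡ length P
      lcp≡∣P∣ = trans (cong₂ lcp (y-split P (a ∷ Q) z≡PaQ) shift≡Pct)
                      (lcp-mismatch P (Q ++ c ∷ t) t λ { refl → <ₑ-irrefl a<c })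

    border-length : IsBorderLength z (lcp y (drop d y))
    border-length with P-proper-prefix
    ... | [] , R≢[] , _ = ⊥-elim (R≢[] refl)
    ... | a ∷ Q , _ , z≡PaQ with <ₑ-compare a c
    ...   | inj₁ a<c        = subst (IsBorderLength z) (sym (lcp≡∣P∣ a<c z≡PaQ)) (P-longest-border a<c z≡PaQ)
    ...   | inj₂ (inj₁ refl) = ⊥-elim (zc-¬inv (P-followed-by-c⇒inverseLyndon z≡PaQ))
    ...   | inj₂ (inj₂ c<a) = ⊥-elim (≺-asym y≺shift
              (subst₂ _≺_ (sym shift≡Pct) (sym (y-split P (a ∷ Q) z≡PaQ)) (≺-mismatch P t (Q ++ c ∷ t) c<a)))

  border-at-next-greater-shift : ∀ y z c t d → y ≡ z ++ c ∷ t →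
    InverseLyndon z → ¬ InverseLyndon (z ++ [ c ]) →
    1 ≤ d → y ≺ drop d y → (∀ k → 1 ≤ k → k < d → ¬ (y ≺ drop k y)) →
    IsBorderLength z (lcp y (drop d y))
  border-at-next-greater-shift _ z c t d refl z-inv zc-¬inv 1≤d y≺shift shift-minimal =
    NextGreaterShift.border-length z c t d z-inv zc-¬inv 1≤d y≺shift shift-minimal

  suf-shift : ∀ x i j → suc i ≤ j → suf x j ≡ drop (j ∸ suc i) (suf x (suc i))
  suf-shift x i j i<j =
    trans (cong (λ k → drop (k ∸ 1) x) (sym (m+[n∸m]≡n i<j))) (sym (drop-drop i (j ∸ suc i) x))

  lce-past-end : ∀ x i → lce x i (suc (length x)) ≡ 0
  lce-past-end x i = trans (cong (lcp (suf x i)) (drop-all (length x) x ≤-refl)) (lcp-[]ʳ (suf x i))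

  border-at-next-greater : ∀ x i e j → MaxInvLyndonAt x (suc i) e → ¬ InverseLyndon (suf x (suc i)) →
    suc i < j → suf x (suc i) ≺ suf x j → (∀ k → suc i < k → k < j → ¬ (suf x (suc i) ≺ suf x k)) →
    IsBorderLength (sub x (suc i) e) (lce x (suc i) j)
  border-at-next-greater x i e j (i<e , e≤n , z-inv , maximal) y-¬inv i<j y≺yⱼ minimal =
    subst (IsBorderLength z) (cong (lcp y) (sym yⱼ≡shift)) (with-next-letter (drop m y) refl)
    where
    y z : Word
    y = suf x (suc i)
    m d : ℕ
    m = e ∸ i
    z = take m y
    d = j ∸ suc i
    yⱼ≡shift : suf x j ≡ drop d y
    yⱼ≡shift = suf-shift x i j (<⇒≤ i<j)
    shift-minimal : ∀ k → 1 ≤ k → k < d → ¬ (y ≺ drop k y)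
    shift-minimal k 1≤k k<d y≺shift = minimal (suc i + k) (m<m+n (suc i) 1≤k)
      (subst (suc i + k <_) (m+[n∸m]≡n (<⇒≤ i<j)) (+-monoʳ-< (suc i) k<d))
      (subst (y ≺_) (drop-drop i k x) y≺shift)
    with-next-letter : ∀ r → drop m y ≡ r → IsBorderLength z (lcp y (drop d y))
    with-next-letter []      rest≡[] = ⊥-elim (y-¬inv (subst InverseLyndon z≡y z-inv))
      where
      z≡y : z ≡ y
      z≡y = trans (sym (++-identityʳ z)) (trans (cong (z ++_) (sym rest≡[])) (take++drop≡id m y))
    with-next-letter (c ∷ t) rest≡ct =
      border-at-next-greater-shift y z c t d (sym (trans (cong (z ++_) (sym rest≡ct)) (take++drop≡id m y)))
        z-inv zc-¬inv (m<n⇒0<n∸m i<j) (subst (y ≺_) yⱼ≡shift y≺yⱼ) shift-minimal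
      where
      e≢n : e ≢ length x
      e≢n e≡n with trans (sym rest≡ct) (drop-all m y (≤-reflexive (trans (length-drop i x) (cong (_∸ i) (sym e≡n)))))
      ... | ()
      zc≡sub : z ++ [ c ] ≡ sub x (suc i) (suc e)
      zc≡sub = sym (trans (cong (λ k → take k y) (+-∸-assoc 1 (<⇒≤ i<e))) (take-suc-∷ʳ m y rest≡ct))
      zc-¬inv : ¬ InverseLyndon (z ++ [ c ])
      zc-¬inv zc-inv = [ e≢n , (λ ¬inv → ¬inv (subst InverseLyndon zc≡sub zc-inv)) ]′ maximal

  letters$ : List A → Word
  letters$ w = map letter w ++ [ dollar ]

  letters$-no-hash : ∀ w → All (_≢ hash) (letters$ w)
  letters$-no-hash w = ++⁺ (map⁺ (All.universal (λ _ ()) w)) ((λ ()) ∷ All.[])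

  initial-border : ∀ {x} → Framed x → ∀ e → 1 ≤ e → IsBorderLength (sub x 1 e) 0
  initial-border (w , refl) (suc e) _ = borderless (λ ()) ≤0
    where
    ≤0 : ∀ b → IsBorder b (hash ∷ take e (letters$ w)) → length b ≤ 0
    ≤0 []      _ = z≤n
    ≤0 (_ ∷ b) ((_ , _ , z≡bu) , (v , v≢[] , z≡vb)) with proj₁ (∷-injective z≡bu) | v
    ... | refl | []     = ⊥-elim (v≢[] refl)
    ... | refl | _ ∷ v′ with ++⁻ʳ v′ (subst (All (_≢ hash)) (proj₂ (∷-injective z≡vb))
                                             (take⁺ e (letters$-no-hash w)))
    ...   | hash≢hash ∷ _ = ⊥-elim (hash≢hash refl)

  last-border : ∀ {x} e → MaxInvLyndonAt x (length x) e → IsBorderLength (sub x (length x) e) 0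
  last-border {x} e (_ , e≤n , z-inv , _) = borderless (proj₁ z-inv) λ b border →
    ≤-pred (<-≤-trans (border-shorter border) ∣z∣≤1)
    where
    n : ℕ
    n = length x
    ∣z∣≤1 : length (sub x n e) ≤ 1
    ∣z∣≤1 = begin
      length (sub x n e)                       ≡⟨ length-take (suc e ∸ n) (drop (n ∸ 1) x) ⟩
      (suc e ∸ n) ⊓ length (drop (n ∸ 1) x)    ≤⟨ m⊓n≤m _ _ ⟩
      suc e ∸ n                                ≤⟨ ∸-monoˡ-≤ n (s≤s e≤n) ⟩
      suc n ∸ n                                ≡⟨ m+n∸n≡m 1 n ⟩
      1                                        ∎
      where open ≤-Reasoning

  length-letters$ : ∀ w → length (letters$ w) ≡ suc (length w)
  length-letters$ []      = refl
  length-letters$ (_ ∷ w) = cong suc (length-letters$ w)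

  drop-letters$ : ∀ i w → i < length w → Σ A λ l → Σ (List A) λ w′ → drop i (letters$ w) ≡ letter l ∷ letters$ w′
  drop-letters$ zero    (l ∷ w) _         = l , w , refl
  drop-letters$ (suc i) (_ ∷ w) (s≤s i<w) = drop-letters$ i w i<w

  drop-length-letters$ : ∀ h w → drop (length (letters$ w)) (h ∷ letters$ w) ≡ [ dollar ]
  drop-length-letters$ h []      = refl
  drop-length-letters$ h (l ∷ w) = drop-length-letters$ (letter l) w

  -- Every interior suffix starts with a letter and ends with $, so it is below x_n = $.
  interior-suffix : ∀ {x i} → Framed x → suc i ≢ 1 → suc i < length x →
    (suf x (suc i) ≺ suf x (length x)) × ¬ InverseLyndon (suf x (suc i))
  interior-suffix {i = zero}  _         i≢1 _   = ⊥-elim (i≢1 refl)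
  interior-suffix {i = suc i} (w , refl) _  i<n with drop-letters$ i w (≤-pred (≤-pred
      (<-≤-trans i<n (≤-reflexive (cong suc (length-letters$ w))))))
  ... | l , w′ , y≡ =
      subst₂ _≺_ (sym y≡) (sym (drop-length-letters$ hash w)) (differ let<dollar)
    , λ y-inv → ≺-asym (differ let<dollar)
        (proj₂ (subst InverseLyndon y≡ y-inv) (letter l ∷ map letter w′) [ dollar ] (λ ()) (λ ()) refl)

  lce-next-greater-is-border : ∀ x → Framed x → ∀ i → 1 ≤ i → i ≤ length x →
    ∀ e → MaxInvLyndonAt x i e → ∀ j → NextGreater x i j → IsBorderLength (sub x i e) (lce x i j)
  lce-next-greater-is-border x fx i _ _ e max _ (conv-first refl) =
    subst (IsBorderLength _) (sym (lce-past-end x 1)) (initial-border fx e (proj₁ max))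
  lce-next-greater-is-border x fx i _ _ e max _ (conv-last refl) =
    subst (IsBorderLength _) (sym (lce-past-end x (length x))) (last-border {x} e max)
  lce-next-greater-is-border x fx zero () _ _ _ _ _
  lce-next-greater-is-border x fx (suc i) _ i≤n e max j (found i≢1 i≢n i<j _ y≺yⱼ minimal) =
    border-at-next-greater x i e j max (proj₂ (interior-suffix fx i≢1 (≤∧≢⇒< i≤n i≢n))) i<j y≺yⱼ minimal
  lce-next-greater-is-border x fx (suc i) _ i≤n e max _ (none i≢1 i≢n none-greater) =
    ⊥-elim (none-greater (length x) (≤∧≢⇒< i≤n i≢n) ≤-refl (proj₁ (interior-suffix fx i≢1 (≤∧≢⇒< i≤n i≢n))))

lemma8 : ∀ {ℓ : Level} (A : Set) (_<_ : Rel A ℓ) (isSTO : IsStrictTotalOrder _≡_ _<_)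
    → let open Alphabet A _<_ isSTO in
    ∀ (x : Word) → Framed x
    → ∀ (i : ℕ) → 1 ≤ i → i ≤ length x
    → ∀ (e : ℕ) → MaxInvLyndonAt x i e
    → ∀ (j : ℕ) → NextGreater x i j
    → IsBorderLength (sub x i e) (lce x i j)
lemma8 = lce-next-greater-is-border
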